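{- Let $X,Y$ be finite posets, for each $x\in X$ let $Y_x\subseteq Y$ be totally ordered, let $\Psi$ be a set of pairs $(x_1,x_2)$ in $X$ with $x_1<x_2$, let $T$ be the set of tableaux $f:X\to Y$ with $f(x)\in Y_x$ for all $x$, $f(x_1)\le f(x_2)$ whenever $x_1\le x_2$, and $f(x_1)<f(x_2)$ whenever $(x_1,x_2)\in\Psi$, and let $E\subseteq X\times Y$ contain $\bigcup_{f\in T}f$. Choose a linear extension $\varepsilon$ of the partial order on $X$. Totally order $T$ as follows: for distinct $f_1,f_2\in T$, let $m$ be the $\varepsilon$-largest element of $X$ at which $f_1$ and $f_2$ differ, and place $f_1$ before $f_2$ if $f_1(m)>f_2(m)$. This order on the facets of $\Delta(X,Y,T,E)$ is a shelling.
   Context: A tableau is a function $f:X\to Y$, identified with its graph in $X\times Y$. With $v_{(x,y)}:=E\setminus\{(x,y)\}$, the tableau complex $\Delta(X,Y,T,E)$ is the simplicial complex on ground set $\{v_{(x,y)}:(x,y)\in E\}$ whose faces are the sets $\{v_{(x,y)}:(x,y)\in E\setminus F\}$ for $F\subseteq E$ containing some $f\in T$; its facets are the $f\in T$ (the facet $f$ has vertex set $\{v_{(x,y)}:(x,y)\in E\setminus f\}$). A shelling of a pure $d$-dimensional simplicial complex is an ordering $F_1,\dots,F_k$ of its facets such that $F_i\cap(F_1\cup\dots\cup F_{i-1})$ is pure of dimension $d-1$ for each $2\le i\le k$. -}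

module Defs where

open import Data.Nat using (ℕ; _+_; _<_; _≤_)
open import Data.Bool using (Bool; true; false; T; _∧_; not)
open import Data.Fin using (Fin; toℕ; _≟_)
open import Data.List using (List; map; allFin)
open import Data.Nat.ListAction using (sum)
open import Data.Product using (Σ; _×_; ∃; ∃-syntax)
open import Data.Sum using (_⊎_)
open import Relation.Nullary using (¬_)
open import Relation.Nullary.Decidable using (⌊_⌋)
open import Relation.Binary.PropositionalEquality using (_≡_; _≢_)

-- X = Fin n, Y = Fin m.  A subset of X × Y is a Bool-valued predicate.
PairSet : ℕ → ℕ → Set
PairSet n m = Fin n → Fin m → Bool

-- A tableau f : X → Y (identified with its graph {(x , f x)}).
Tableau : ℕ → ℕ → Set
Tableau n m = Fin n → Fin m

_⊆ₚ_ : ∀ {n m} → PairSet n m → PairSet n m → Set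
_⊆ₚ_ {n} {m} S S' = (x : Fin n) (y : Fin m) → T (S x y) → T (S' x y)

boolToℕ : Bool → ℕ
boolToℕ true  = 1
boolToℕ false = 0

card : ∀ {n m} → PairSet n m → ℕ
card {n} {m} S = sum (map (λ x → sum (map (λ y → boolToℕ (S x y)) (allFin m))) (allFin n))

-- vertex set of the facet of the tableau complex corresponding to f : E ∖ f
facetOf : ∀ {n m} → PairSet n m → Tableau n m → PairSet n m
facetOf E f x y = E x y ∧ not ⌊ f x ≟ y ⌋

IsTableau : ∀ {n m}
  (_≤X_ : Fin n → Fin n → Set) (_≤Y_ : Fin m → Fin m → Set)
  (Yx : Fin n → Fin m → Set) (Ψ : Fin n → Fin n → Set) → Tableau n m → Set
IsTableau {n} _≤X_ _≤Y_ Yx Ψ f =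
  ((x : Fin n) → Yx x (f x)) ×
  ((x₁ x₂ : Fin n) → x₁ ≤X x₂ → f x₁ ≤Y f x₂) ×
  ((x₁ x₂ : Fin n) → Ψ x₁ x₂ → (f x₁ ≤Y f x₂) × (f x₁ ≢ f x₂))

-- ε : X → {0,…,n-1} injective (hence a bijection), monotone: a linear extension
IsLinearExtension : ∀ {n} (_≤X_ : Fin n → Fin n → Set) → (Fin n → Fin n) → Set
IsLinearExtension {n} _≤X_ ε =
  ((x x' : Fin n) → ε x ≡ ε x' → x ≡ x') ×
  ((x x' : Fin n) → x ≤X x' → toℕ (ε x) ≤ toℕ (ε x'))

Before : ∀ {n m} (_≤Y_ : Fin m → Fin m → Set) (ε : Fin n → Fin n) →
  Tableau n m → Tableau n m → Set
Before {n} _≤Y_ ε f₁ f₂ =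
  Σ (Fin n) λ p →
    (f₁ p ≢ f₂ p) ×
    ((x : Fin n) → toℕ (ε p) < toℕ (ε x) → f₁ x ≡ f₂ x) ×
    (f₂ p ≤Y f₁ p)

InIntersection : ∀ {n m k} → (Fin k → PairSet n m) → Fin k → PairSet n m → Set
InIntersection {k = k} F i G =
  (G ⊆ₚ F i) × (Σ (Fin k) λ j → (toℕ j < toℕ i) × (G ⊆ₚ F j))

-- the subcomplex F_i ∩ (F_0 ∪ … ∪ F_{i-1}) is pure of dimension d - 1,
-- where d = card (F i) - 1: every maximal face has card (F i) - 1 elements
PureCodimOne : ∀ {n m k} → (Fin k → PairSet n m) → Fin k → Set
PureCodimOne {n} {m} F i =
  (G : PairSet n m) → InIntersection F i G →
  ((G' : PairSet n m) → InIntersection F i G' → G ⊆ₚ G' → G' ⊆ₚ G) →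
  card G + 1 ≡ card (F i)

IsShelling : ∀ {n m k} → (Fin k → PairSet n m) → Set
IsShelling {k = k} F =
  ((i j : Fin k) → card (F i) ≡ card (F j)) ×
  ((i : Fin k) → 1 ≤ toℕ i → PureCodimOne F i)

{-# OPTIONS --safe #-}
module Submission where

-- All facets have |E| - |X| vertices.  For j < i let p be the ε-largest point where L j
-- and L i differ, so L i p < L j p.  Raising the value of L i at p to L j p gives again a
-- tableau: every x > p in X lies ε-above p, where L i already agrees with L j, whose values
-- there are ≥ L j p.  This tableau differs from L i only at p and comes before it, say it
-- is L j'.  Then F_i ∩ F_j ⊆ F_i ∩ F_j', which is F_i with the single vertex (p , L j p)
-- removed; hence every maximal face of F_i ∩ (F_0 ∪ … ∪ F_{i-1}) has codimension one.

open import Defs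
open import Data.Nat using (ℕ; suc; _+_; _<_)
open import Data.Nat.Properties using (+-suc; +-comm; suc-injective; ≤∧≢⇒<; <-irrefl)
open import Data.Nat.ListAction using (sum)
open import Data.Bool using (Bool; true; false; T; _∧_)
open import Data.Bool.Properties using (T-∧)
open import Data.Fin using (Fin; zero; suc; toℕ; _≟_)
import Data.Fin.Properties as Fin
open import Data.List using (map; allFin)
open import Data.List.Properties using (map-cong; map-tabulate)
open import Data.Vec.Functional using (updateAt)
open import Data.Vec.Functional.Properties using (updateAt-updates; updateAt-minimal)
open import Data.Product using (Σ; _×_; _,_; proj₁; proj₂)
open import Data.Sum using (_⊎_; inj₁; inj₂)
open import Data.Empty using (⊥-elim)
open import Function using (_∘_; id; const; Equivalence)
open import Relation.Nullary using (¬_; yes; no)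
open import Relation.Nullary.Decidable using (fromWitnessFalse; toWitnessFalse)
open import Relation.Binary.Definitions using (Asymmetric; tri<; tri≈; tri>)
open import Relation.Binary.Structures using (IsPartialOrder)
open import Relation.Binary.PropositionalEquality
  using (_≡_; _≢_; _≗_; refl; sym; trans; cong; cong₂; subst; module ≡-Reasoning)

open Equivalence using (to; from)

∑ : ∀ {m} → (Fin m → ℕ) → ℕ
∑ {m} g = sum (map g (allFin m))

∑-cong : ∀ {m} {g g' : Fin m → ℕ} → g ≗ g' → ∑ g ≡ ∑ g'
∑-cong {m} g≗g' = cong sum (map-cong g≗g' (allFin m))

∑-suc : ∀ {m} (g : Fin (suc m) → ℕ) → ∑ g ≡ g zero + ∑ (g ∘ suc)
∑-suc g = cong (λ xs → g zero + sum xs)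
  (trans (map-tabulate suc g) (sym (map-tabulate id (g ∘ suc))))

∑-except : ∀ {m} {g g' : Fin m → ℕ} (y₀ : Fin m) →
  g y₀ ≡ suc (g' y₀) → (∀ y → y ≢ y₀ → g' y ≡ g y) → ∑ g ≡ suc (∑ g')
∑-except {suc m} {g} {g'} zero at off = begin
  ∑ g                           ≡⟨ ∑-suc g ⟩
  g zero + ∑ (g ∘ suc)          ≡⟨ cong₂ _+_ at (∑-cong λ y → sym (off (suc y) λ ())) ⟩
  suc (g' zero + ∑ (g' ∘ suc))  ≡⟨ cong suc (∑-suc g') ⟨
  suc (∑ g')                    ∎
  where open ≡-Reasoning
∑-except {suc m} {g} {g'} (suc y₀) at off = begin
  ∑ g                           ≡⟨ ∑-suc g ⟩
  g zero + ∑ (g ∘ suc)          ≡⟨ cong₂ _+_ (sym (off zero λ ())) (∑-except y₀ at off-suc) ⟩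
  g' zero + suc (∑ (g' ∘ suc))  ≡⟨ +-suc _ _ ⟩
  suc (g' zero + ∑ (g' ∘ suc))  ≡⟨ cong suc (∑-suc g') ⟨
  suc (∑ g')                    ∎
  where
  open ≡-Reasoning
  off-suc : ∀ y → y ≢ y₀ → g' (suc y) ≡ g (suc y)
  off-suc y y≢y₀ = off (suc y) (y≢y₀ ∘ Fin.suc-injective)

T-injective : ∀ {a b} → (T a → T b) → (T b → T a) → a ≡ b
T-injective {false} {false} _ _ = refl
T-injective {false} {true}  _ b⇒a = ⊥-elim (b⇒a _)
T-injective {true}  {false} a⇒b _ = ⊥-elim (a⇒b _)
T-injective {true}  {true}  _ _ = refl

boolToℕ-except : ∀ {a b} → T a → ¬ T b → boolToℕ a ≡ suc (boolToℕ b)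
boolToℕ-except {true} {false} _ _  = refl
boolToℕ-except {true} {true}  _ ¬b = ⊥-elim (¬b _)

∑-boolToℕ-except : ∀ {m} {b b' : Fin m → Bool} (y₀ : Fin m) → T (b y₀) → ¬ T (b' y₀) →
  (∀ y → y ≢ y₀ → b' y ≡ b y) → ∑ (boolToℕ ∘ b) ≡ suc (∑ (boolToℕ ∘ b'))
∑-boolToℕ-except y₀ b-y₀ ¬b'-y₀ off =
  ∑-except y₀ (boolToℕ-except b-y₀ ¬b'-y₀) (λ y → cong boolToℕ ∘ off y)

card-cong : ∀ {n m} {S S' : PairSet n m} → S ⊆ₚ S' → S' ⊆ₚ S → card S ≡ card S'
card-cong S⊆S' S'⊆S =
  ∑-cong λ x → ∑-cong λ y → cong boolToℕ (T-injective (S⊆S' x y) (S'⊆S x y))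

card-except : ∀ {n m} {S S' : PairSet n m} (x₀ : Fin n) (y₀ : Fin m) →
  T (S x₀ y₀) → ¬ T (S' x₀ y₀) → (∀ x y → (x , y) ≢ (x₀ , y₀) → S' x y ≡ S x y) →
  card S ≡ suc (card S')
card-except x₀ y₀ S-x₀y₀ ¬S'-x₀y₀ off =
  ∑-except x₀ (∑-boolToℕ-except y₀ S-x₀y₀ ¬S'-x₀y₀ (λ y y≢y₀ → off x₀ y (y≢y₀ ∘ cong proj₂)))
    (λ x x≢x₀ → ∑-cong λ y → cong boolToℕ (off x y (x≢x₀ ∘ cong proj₁)))

_∩ₚ_ : ∀ {n m} → PairSet n m → PairSet n m → PairSet n m
(S ∩ₚ S') x y = S x y ∧ S' x y

∩-⊆ˡ : ∀ {n m} {S S' : PairSet n m} → (S ∩ₚ S') ⊆ₚ S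
∩-⊆ˡ x y = proj₁ ∘ to T-∧

∩-⊆ʳ : ∀ {n m} {S S' : PairSet n m} → (S ∩ₚ S') ⊆ₚ S'
∩-⊆ʳ x y = proj₂ ∘ to T-∧

⊆-∩ : ∀ {n m} {G S S' : PairSet n m} → G ⊆ₚ S → G ⊆ₚ S' → G ⊆ₚ (S ∩ₚ S')
⊆-∩ G⊆S G⊆S' x y g = from T-∧ (G⊆S x y g , G⊆S' x y g)

pureCodimOne-criterion : ∀ {n m k} (F : Fin k → PairSet n m) (i : Fin k) →
  (∀ j → toℕ j < toℕ i → Σ (Fin k) λ j' → toℕ j' < toℕ i ×
     ((F i ∩ₚ F j) ⊆ₚ F j') × card (F i) ≡ suc (card (F i ∩ₚ F j'))) →
  PureCodimOne F i
pureCodimOne-criterion F i exchange G (G⊆Fi , j , j<i , G⊆Fj) G-maximal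
  with exchange j j<i
... | j' , j'<i , Fi∩Fj⊆Fj' , card-Fi = begin
  card G + 1                ≡⟨ +-comm (card G) 1 ⟩
  suc (card G)              ≡⟨ cong suc (card-cong G⊆G' (G-maximal G' G'-face G⊆G')) ⟩
  suc (card (F i ∩ₚ F j'))  ≡⟨ card-Fi ⟨
  card (F i)                ∎
  where
  open ≡-Reasoning
  G' : PairSet _ _
  G' = F i ∩ₚ F j'
  G'-face : InIntersection F i G'
  G'-face = ∩-⊆ˡ , j' , j'<i , ∩-⊆ʳ
  G⊆G' : G ⊆ₚ G'
  G⊆G' = ⊆-∩ G⊆Fi λ x y → Fi∩Fj⊆Fj' x y ∘ ⊆-∩ G⊆Fi G⊆Fj x y

module _ {n m} (E : PairSet n m) (f : Tableau n m) {x : Fin n} {y : Fin m} where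

  ∈-facetOf⁺ : T (E x y) → f x ≢ y → T (facetOf E f x y)
  ∈-facetOf⁺ xy∈E fx≢y = from (T-∧ {E x y}) (xy∈E , fromWitnessFalse {a? = f x ≟ y} fx≢y)

  ∈-facetOf⁻ : T (facetOf E f x y) → T (E x y) × f x ≢ y
  ∈-facetOf⁻ xy∈F = let xy∈E , fx≢y = to (T-∧ {E x y}) xy∈F in
    xy∈E , toWitnessFalse {a? = f x ≟ y} fx≢y

card-facetOf-cong : ∀ {n m} {E : PairSet n m} {f g : Tableau n m} →
  (∀ x → T (E x (f x))) → (∀ x → T (E x (g x))) → card (facetOf E f) ≡ card (facetOf E g)
card-facetOf-cong {E = E} f⊆E g⊆E = ∑-cong λ x →
  suc-injective (trans (sym (row-except f⊆E x)) (row-except g⊆E x))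
  where
  row-except : ∀ {f} → (∀ x → T (E x (f x))) → ∀ x →
    ∑ (boolToℕ ∘ E x) ≡ suc (∑ (boolToℕ ∘ facetOf E f x))
  row-except {f} f⊆E x =
    ∑-boolToℕ-except (f x) (f⊆E x) (λ xfx∈F → proj₂ (∈-facetOf⁻ E f xfx∈F) refl)
      (λ y y≢fx → T-injective (proj₁ ∘ ∈-facetOf⁻ E f) (λ xy∈E → ∈-facetOf⁺ E f xy∈E (y≢fx ∘ sym)))

facetOf-∩-⊆ : ∀ {n m} {E : PairSet n m} {f g h : Tableau n m} →
  (∀ x → h x ≡ f x ⊎ h x ≡ g x) → (facetOf E f ∩ₚ facetOf E g) ⊆ₚ facetOf E h
facetOf-∩-⊆ {E = E} {f} {g} {h} h≡f⊎g x y xy∈F =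
  ∈-facetOf⁺ E h xy∈E hx≢y
  where
  xy∈Ff : T (facetOf E f x y)
  xy∈Ff = ∩-⊆ˡ {S = facetOf E f} {facetOf E g} x y xy∈F
  xy∈Fg : T (facetOf E g x y)
  xy∈Fg = ∩-⊆ʳ {S = facetOf E f} {facetOf E g} x y xy∈F
  xy∈E : T (E x y)
  xy∈E = proj₁ (∈-facetOf⁻ E f xy∈Ff)
  hx≢y : h x ≢ y
  hx≢y with h≡f⊎g x
  ... | inj₁ hx≡fx = subst (_≢ y) (sym hx≡fx) (proj₂ (∈-facetOf⁻ E f xy∈Ff))
  ... | inj₂ hx≡gx = subst (_≢ y) (sym hx≡gx) (proj₂ (∈-facetOf⁻ E g xy∈Fg))

card-facetOf-∩-adjacent : ∀ {n m} {E : PairSet n m} {f g : Tableau n m} (p : Fin n) →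
  (∀ x → x ≢ p → g x ≡ f x) → f p ≢ g p → T (E p (g p)) →
  card (facetOf E f) ≡ suc (card (facetOf E f ∩ₚ facetOf E g))
card-facetOf-∩-adjacent {E = E} {f} {g} p g≡f fp≢gp pgp∈E =
  card-except p (g p) (∈-facetOf⁺ E f pgp∈E fp≢gp) pgp∉Ff∩Fg Ff∩Fg≡Ff
  where
  Ff Fg : PairSet _ _
  Ff = facetOf E f
  Fg = facetOf E g
  pgp∉Ff∩Fg : ¬ T ((Ff ∩ₚ Fg) p (g p))
  pgp∉Ff∩Fg pgp∈F = proj₂ (∈-facetOf⁻ E g (∩-⊆ʳ {S = Ff} {Fg} p (g p) pgp∈F)) refl
  Ff⊆Fg : ∀ {x y} → (x , y) ≢ (p , g p) → T (Ff x y) → T (Fg x y)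
  Ff⊆Fg {x} {y} xy≢pgp xy∈Ff = ∈-facetOf⁺ E g (proj₁ (∈-facetOf⁻ E f xy∈Ff)) gx≢y
    where
    gx≢y : g x ≢ y
    gx≢y with x ≟ p
    ... | yes x≡p = λ gx≡y → xy≢pgp (cong₂ _,_ x≡p (trans (sym gx≡y) (cong g x≡p)))
    ... | no x≢p = subst (_≢ y) (sym (g≡f x x≢p)) (proj₂ (∈-facetOf⁻ E f xy∈Ff))
  Ff∩Fg≡Ff : ∀ x y → (x , y) ≢ (p , g p) → (Ff ∩ₚ Fg) x y ≡ Ff x y
  Ff∩Fg≡Ff x y xy≢pgp = T-injective (∩-⊆ˡ {S = Ff} {Fg} x y)
    (λ xy∈Ff → from T-∧ (xy∈Ff , Ff⊆Fg xy≢pgp xy∈Ff))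

sorted-index-< : ∀ {a ℓ} {A : Set a} {R : A → A → Set ℓ} → Asymmetric R →
  ∀ {k} {L : Fin k → A} → (∀ i j → toℕ i < toℕ j → R (L i) (L j)) →
  ∀ {i j} → R (L i) (L j) → toℕ i < toℕ j
sorted-index-< R-asym sorted {i} {j} R-ij with Fin.<-cmp i j
... | tri< i<j _ _ = i<j
... | tri≈ _ refl _ = ⊥-elim (R-asym R-ij R-ij)
... | tri> _ _ j<i = ⊥-elim (R-asym R-ij (sorted j i j<i))

module Tableaux {n m} {_≤X_ : Fin n → Fin n → Set} {_≤Y_ : Fin m → Fin m → Set}
  (≤Y-po : IsPartialOrder _≡_ _≤Y_) {ε : Fin n → Fin n} (ε-lin : IsLinearExtension _≤X_ ε) where

  open IsPartialOrder ≤Y-po using (antisym) renaming (refl to ≤Y-refl; trans to ≤Y-trans)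

  ε-injective : ∀ {x x'} → ε x ≡ ε x' → x ≡ x'
  ε-injective = proj₁ ε-lin _ _

  ε-strictMono : ∀ {x x'} → x ≤X x' → x ≢ x' → toℕ (ε x) < toℕ (ε x')
  ε-strictMono x≤x' x≢x' = ≤∧≢⇒< (proj₂ ε-lin _ _ x≤x') (x≢x' ∘ ε-injective ∘ Fin.toℕ-injective)

  Before-asym : Asymmetric (Before _≤Y_ ε)
  Before-asym (p , fp≢gp , f≡g-above , gp≤fp) (q , gq≢fq , g≡f-above , fq≤gq)
    with Fin.<-cmp (ε p) (ε q)
  ... | tri< εp<εq _ _ = gq≢fq (sym (f≡g-above q εp<εq))
  ... | tri> _ _ εq<εp = fp≢gp (sym (g≡f-above p εq<εp))
  ... | tri≈ _ εp≡εq _ with ε-injective εp≡εq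
  ...   | refl = fp≢gp (antisym fq≤gq gp≤fp)

  Before-raised : ∀ {f g : Tableau n m} (p : Fin n) →
    (∀ x → x ≢ p → g x ≡ f x) → f p ≤Y g p → g p ≢ f p → Before _≤Y_ ε g f
  Before-raised p g≡f fp≤gp gp≢fp =
    p , gp≢fp , (λ x εp<εx → g≡f x λ { refl → <-irrefl refl εp<εx }) , fp≤gp

  module _ {Yx : Fin n → Fin m → Set} {Ψ : Fin n → Fin n → Set}
    (Ψ⇒< : ∀ x₁ x₂ → Ψ x₁ x₂ → (x₁ ≤X x₂) × (x₁ ≢ x₂)) where

    raise-isTableau : ∀ {f g : Tableau n m} (p : Fin n) →
      IsTableau _≤X_ _≤Y_ Yx Ψ f → IsTableau _≤X_ _≤Y_ Yx Ψ g →
      f p ≤Y g p → (∀ x → toℕ (ε p) < toℕ (ε x) → g x ≡ f x) →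
      IsTableau _≤X_ _≤Y_ Yx Ψ (updateAt f p (const (g p)))
    raise-isTableau {f} {g} p (f-Y , f-mono , f-Ψ) (g-Y , g-mono , g-Ψ) fp≤gp g≡f-above =
      h-Y , h-mono , h-Ψ
      where
      h : Tableau n m
      h = updateAt f p (const (g p))
      h-p : h p ≡ g p
      h-p = updateAt-updates p f
      h-off : ∀ x → x ≢ p → h x ≡ f x
      h-off x = updateAt-minimal x p f
      g≡f-up : ∀ {x} → p ≤X x → x ≢ p → g x ≡ f x
      g≡f-up p≤x x≢p = g≡f-above _ (ε-strictMono p≤x (x≢p ∘ sym))
      gp≤f-up : ∀ {x} → p ≤X x → x ≢ p → g p ≤Y f x
      gp≤f-up p≤x x≢p = subst (g p ≤Y_) (g≡f-up p≤x x≢p) (g-mono _ _ p≤x)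
      f≤gp-down : ∀ {x} → x ≤X p → f x ≤Y g p
      f≤gp-down x≤p = ≤Y-trans (f-mono _ _ x≤p) fp≤gp

      h-Y : ∀ x → Yx x (h x)
      h-Y x with x ≟ p
      ... | yes refl rewrite h-p = g-Y p
      ... | no x≢p rewrite h-off x x≢p = f-Y x

      h-mono : ∀ x₁ x₂ → x₁ ≤X x₂ → h x₁ ≤Y h x₂
      h-mono x₁ x₂ x₁≤x₂ with x₁ ≟ p | x₂ ≟ p
      ... | yes refl | yes refl = ≤Y-refl
      ... | yes refl | no x₂≢p rewrite h-p | h-off x₂ x₂≢p = gp≤f-up x₁≤x₂ x₂≢p
      ... | no x₁≢p | yes refl rewrite h-p | h-off x₁ x₁≢p = f≤gp-down x₁≤x₂
      ... | no x₁≢p | no x₂≢p rewrite h-off x₁ x₁≢p | h-off x₂ x₂≢p = f-mono x₁ x₂ x₁≤x₂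

      h-Ψ : ∀ x₁ x₂ → Ψ x₁ x₂ → (h x₁ ≤Y h x₂) × (h x₁ ≢ h x₂)
      h-Ψ x₁ x₂ ψ with Ψ⇒< x₁ x₂ ψ | x₁ ≟ p | x₂ ≟ p
      ... | _ , x₁≢x₂ | yes refl | yes refl = ⊥-elim (x₁≢x₂ refl)
      ... | x₁≤x₂ , _ | yes refl | no x₂≢p rewrite h-p | h-off x₂ x₂≢p =
        gp≤f-up x₁≤x₂ x₂≢p ,
        λ gp≡fx₂ → proj₂ (g-Ψ p x₂ ψ) (trans gp≡fx₂ (sym (g≡f-up x₁≤x₂ x₂≢p)))
      ... | x₁≤x₂ , _ | no x₁≢p | yes refl rewrite h-p | h-off x₁ x₁≢p =
        f≤gp-down x₁≤x₂ , λ fx₁≡gp → proj₂ (f-Ψ x₁ p ψ)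
          (antisym (f-mono x₁ p x₁≤x₂) (subst (f p ≤Y_) (sym fx₁≡gp) fp≤gp))
      ... | _ | no x₁≢p | no x₂≢p rewrite h-off x₁ x₁≢p | h-off x₂ x₂≢p = f-Ψ x₁ x₂ ψ

    module _ {E : PairSet n m} (graph⊆E : ∀ f → IsTableau _≤X_ _≤Y_ Yx Ψ f → ∀ x → T (E x (f x)))
      {k} {L : Fin k → Tableau n m} (L-tableau : ∀ i → IsTableau _≤X_ _≤Y_ Yx Ψ (L i))
      (L-complete : ∀ f → IsTableau _≤X_ _≤Y_ Yx Ψ f → Σ (Fin k) λ i → ∀ x → L i x ≡ f x)
      (L-sorted : ∀ i j → toℕ i < toℕ j → Before _≤Y_ ε (L i) (L j)) where

      exchange : ∀ i j → toℕ j < toℕ i → Σ (Fin k) λ j' → toℕ j' < toℕ i ×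
        ((facetOf E (L i) ∩ₚ facetOf E (L j)) ⊆ₚ facetOf E (L j')) ×
        card (facetOf E (L i)) ≡ suc (card (facetOf E (L i) ∩ₚ facetOf E (L j')))
      exchange i j j<i with L-sorted j i j<i
      ... | p , Ljp≢Lip , Lj≡Li-above , Lip≤Ljp
        with L-complete _ (raise-isTableau p (L-tableau i) (L-tableau j) Lip≤Ljp Lj≡Li-above)
      ... | j' , Lj'≡h =
        j' , j'<i , facetOf-∩-⊆ {E = E} Lj'≡Li⊎Lj ,
        card-facetOf-∩-adjacent {E = E} p Lj'≡Li-off (Lj'p≢Lip ∘ sym) (graph⊆E _ (L-tableau j') p)
        where
        Lj'p≡Ljp : L j' p ≡ L j p
        Lj'p≡Ljp = trans (Lj'≡h p) (updateAt-updates p (L i))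
        Lj'≡Li-off : ∀ x → x ≢ p → L j' x ≡ L i x
        Lj'≡Li-off x x≢p = trans (Lj'≡h x) (updateAt-minimal x p (L i) x≢p)
        Lj'p≢Lip : L j' p ≢ L i p
        Lj'p≢Lip = Ljp≢Lip ∘ trans (sym Lj'p≡Ljp)
        j'<i : toℕ j' < toℕ i
        j'<i = sorted-index-< {R = Before _≤Y_ ε} Before-asym L-sorted
          (Before-raised p Lj'≡Li-off (subst (L i p ≤Y_) (sym Lj'p≡Ljp) Lip≤Ljp) Lj'p≢Lip)
        Lj'≡Li⊎Lj : ∀ x → L j' x ≡ L i x ⊎ L j' x ≡ L j x
        Lj'≡Li⊎Lj x with x ≟ p
        ... | yes refl = inj₂ Lj'p≡Ljp
        ... | no x≢p = inj₁ (Lj'≡Li-off x x≢p)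

theorem2p13 : (n m : ℕ)
    (_≤X_ : Fin n → Fin n → Set) → IsPartialOrder _≡_ _≤X_ →
    (_≤Y_ : Fin m → Fin m → Set) → IsPartialOrder _≡_ _≤Y_ →
    (Yx : Fin n → Fin m → Set) →
    ((x : Fin n) (y y' : Fin m) → Yx x y → Yx x y' → (y ≤Y y') ⊎ (y' ≤Y y)) →
    (Ψ : Fin n → Fin n → Set) →
    ((x₁ x₂ : Fin n) → Ψ x₁ x₂ → (x₁ ≤X x₂) × (x₁ ≢ x₂)) →
    (E : PairSet n m) →
    ((f : Tableau n m) → IsTableau _≤X_ _≤Y_ Yx Ψ f → (x : Fin n) → T (E x (f x))) →
    (ε : Fin n → Fin n) → IsLinearExtension _≤X_ ε →
    (k : ℕ) (L : Fin k → Tableau n m) →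
    ((i : Fin k) → IsTableau _≤X_ _≤Y_ Yx Ψ (L i)) →
    ((f : Tableau n m) → IsTableau _≤X_ _≤Y_ Yx Ψ f →
      Σ (Fin k) λ i → (x : Fin n) → L i x ≡ f x) →
    ((i j : Fin k) → toℕ i < toℕ j → Before _≤Y_ ε (L i) (L j)) →
    IsShelling (λ i → facetOf E (L i))
theorem2p13 n m _≤X_ _ _≤Y_ ≤Y-po Yx _ Ψ Ψ⇒< E graph⊆E ε ε-lin k L L-tableau L-complete L-sorted =
  (λ i j → card-facetOf-cong {E = E} (graph⊆E _ (L-tableau i)) (graph⊆E _ (L-tableau j))) ,
  (λ i _ → pureCodimOne-criterion _ i
     (exchange {Yx = Yx} Ψ⇒< graph⊆E L-tableau L-complete L-sorted i))
  where open Tableaux ≤Y-po ε-lin
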